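{- Let $G=(V,E)$ be a graph, $s\in\mathbb{N}$, and $\ell := 2|E|+1$. Then $(G,s)$ is a yes-instance of \textsc{Node Clique Cover} if and only if $(G^{\ell}, \ell(|V|+s+1)-1)$ is a yes-instance of \textsc{Sigma Clique Cover}.
   Context: Graphs are finite, simple, undirected. For a graph $G=(V,E)$ and $\ell\in\mathbb{N}$, $G^{\ell}$ is the graph obtained by adding $\ell$ new vertices $u_1,\dots,u_\ell$ and all edges $u_iv$ for $1\le i\le\ell$, $v\in V$ (no edges among the $u_i$): $G^{\ell} = (V\cup\{u_1,\dots,u_\ell\}, E\cup\{u_iv : 1\le i\le\ell, v\in V\})$. A \emph{node clique cover} of $G$ is a set $\mathcal{C}$ of subsets of $V$ such that $G[C]$ is a clique for every $C\in\mathcal{C}$ and every vertex of $G$ lies in some $C\in\mathcal{C}$; its size is $|\mathcal{C}|$. \textsc{Node Clique Cover}: given $(G,k)$, decide whether $G$ has a node clique cover of size at most $k$. A \emph{sigma clique cover} of $G$ is a set $\mathcal{C}$ of subsets of $V(G)$ such that $G[C]$ is a clique for every $C\in\mathcal{C}$ and for every edge $uv$ there is $C\in\mathcal{C}$ with $\{u,v\}\subseteq C$; its weight is $\mathrm{wgt}(\mathcal{C})=\sum_{C\in\mathcal{C}}|C|$. \textsc{Sigma Clique Cover}: given $(G,s)$, decide whether $G$ has a sigma clique cover of weight at most $s$. -}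

module Defs where

open import Data.Nat using (ℕ; zero; suc; _+_; _*_; _∸_; _≤_; _<ᵇ_)
open import Data.Bool using (Bool; true; false; _∧_; if_then_else_)
open import Data.Fin using (Fin; toℕ; splitAt)
open import Data.Fin.Subset using (Subset; _∈_; ∣_∣)
open import Data.List using (List; length; map; allFin)
open import Data.Nat.ListAction using (sum)
open import Data.List.Relation.Unary.All using (All)
open import Data.List.Relation.Unary.Any using (Any)
open import Data.Sum using (_⊎_; inj₁; inj₂)
open import Data.Product using (Σ; ∃; _×_; _,_)
open import Relation.Binary.PropositionalEquality using (_≡_; _≢_; refl)

record Graph : Set where
  field
    n      : ℕ
    adj    : Fin n → Fin n → Bool
    sym    : ∀ i j → adj i j ≡ adj j i
    irrefl : ∀ i → adj i i ≡ false
open Graph public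

∣V∣ : Graph → ℕ
∣V∣ G = n G

∣E∣ : Graph → ℕ
∣E∣ G = sum (map (λ i → sum (map (λ j →
          if adj G i j ∧ (toℕ i <ᵇ toℕ j) then 1 else 0) (allFin (n G)))) (allFin (n G)))

-- adjacency of G^ℓ on Fin (n + ℓ): first n vertices are V, last ℓ are u_1..u_ℓ
adjPow : (G : Graph) (ℓ : ℕ) → Fin (n G + ℓ) → Fin (n G + ℓ) → Bool
adjPow G ℓ x y with splitAt (n G) x | splitAt (n G) y
... | inj₁ a | inj₁ b = adj G a b
... | inj₁ a | inj₂ _ = true
... | inj₂ _ | inj₁ b = true
... | inj₂ _ | inj₂ _ = false

adjPow-sym : (G : Graph) (ℓ : ℕ) → ∀ x y → adjPow G ℓ x y ≡ adjPow G ℓ y x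
adjPow-sym G ℓ x y with splitAt (n G) x | splitAt (n G) y
... | inj₁ a | inj₁ b = sym G a b
... | inj₁ a | inj₂ _ = refl
... | inj₂ _ | inj₁ b = refl
... | inj₂ _ | inj₂ _ = refl

adjPow-irrefl : (G : Graph) (ℓ : ℕ) → ∀ x → adjPow G ℓ x x ≡ false
adjPow-irrefl G ℓ x with splitAt (n G) x
... | inj₁ a = irrefl G a
... | inj₂ _ = refl

_^^_ : Graph → ℕ → Graph
G ^^ ℓ = record
  { n = n G + ℓ ; adj = adjPow G ℓ ; sym = adjPow-sym G ℓ ; irrefl = adjPow-irrefl G ℓ }

IsClique : (G : Graph) → Subset (n G) → Set
IsClique G C = ∀ i j → i ∈ C → j ∈ C → i ≢ j → adj G i j ≡ true

IsNodeCliqueCover : (G : Graph) → List (Subset (n G)) → Set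
IsNodeCliqueCover G 𝒞 =
  All (IsClique G) 𝒞 × (∀ v → Any (λ C → v ∈ C) 𝒞)

IsSigmaCliqueCover : (G : Graph) → List (Subset (n G)) → Set
IsSigmaCliqueCover G 𝒞 =
  All (IsClique G) 𝒞 ×
  (∀ u v → adj G u v ≡ true → Any (λ C → u ∈ C × v ∈ C) 𝒞)

wgt : ∀ {m} → List (Subset m) → ℕ
wgt 𝒞 = sum (map ∣_∣ 𝒞)

NodeCliqueCoverYes : Graph → ℕ → Set
NodeCliqueCoverYes G k = Σ (List (Subset (n G))) λ 𝒞 →
  IsNodeCliqueCover G 𝒞 × length 𝒞 ≤ k

SigmaCliqueCoverYes : Graph → ℕ → Set
SigmaCliqueCoverYes G s = Σ (List (Subset (n G))) λ 𝒞 →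
  IsSigmaCliqueCover G 𝒞 × wgt 𝒞 ≤ s

-- A clique of G^ℓ is a clique of G together with at most one new vertex u_j.
-- Forward: make the node clique cover 𝒟 of G disjoint (so wgt 𝒟 ≤ |V|) and
-- take the cliques D ∪ {u_j} for all D ∈ 𝒟 and all j, plus one clique {a,b}
-- per edge of G; the weight is ℓ(wgt 𝒟 + |𝒟|) + 2|E| ≤ ℓ(|V| + s) + ℓ - 1.
-- Backward: the cliques through u_j, restricted to V, form a node clique cover
-- 𝒯ⱼ of G, since every edge v u_j is covered.  A clique A ∪ {u_j} occurs in
-- 𝒯ⱼ only, where it costs |A| + 1, so Σⱼ (wgt 𝒯ⱼ + |𝒯ⱼ|) is at most the weight
-- of the sigma cover, which is below ℓ(|V| + s + 1).  Hence some j has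
-- wgt 𝒯ⱼ + |𝒯ⱼ| ≤ |V| + s, and wgt 𝒯ⱼ ≥ |V| gives |𝒯ⱼ| ≤ s.
module Submission where

open import Defs renaming (sym to adj-sym)
open import Data.Bool using (Bool; true; false; _∧_; if_then_else_)
open import Data.Bool.Properties using (T-≡)
open import Data.Fin using (Fin; zero; suc; toℕ; _↑ˡ_; _↑ʳ_; splitAt)
open import Data.Fin.Properties
  using (splitAt-↑ˡ; splitAt-↑ʳ; splitAt⁻¹-↑ˡ; splitAt⁻¹-↑ʳ; ↑ˡ-injective; ↑ʳ-injective; toℕ-injective)
import Data.Fin.Properties as Fin
open import Data.Fin.Subset using (Subset; Empty; _∈_; _⊆_; ∣_∣; _∪_; _─_; ⊥; ⊤; ⁅_⁆; ⋃)
open import Data.Fin.Subset.Properties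
  using (∣⊤∣≡n; ∣⊥∣≡0; ∉⊥; Empty-unique; x∈⁅x⁆; x∈⁅y⁆⇒x≡y; ∣⁅x⁆∣≡1; p⊆q⇒∣p∣≤∣q∣; ∣p∣≤n;
         x∈p∪q⁺; x∈p∪q⁻; x∈p∧x∉q⇒x∈p─q; p─q⊆p; _∈?_)
open import Data.List using (List; []; _∷_; length; map; concatMap; allFin)
import Data.List as L
open import Data.List.Properties using (map-++; map-cong; length-tabulate)
open import Data.List.Relation.Unary.All using (All; []; _∷_)
import Data.List.Relation.Unary.All as All
import Data.List.Relation.Unary.All.Properties as All
open import Data.List.Relation.Unary.Any using (Any; here; there)
import Data.List.Relation.Unary.Any as Any
import Data.List.Relation.Unary.Any.Properties as Any
open import Data.Nat using (ℕ; zero; suc; _+_; _*_; _∸_; _≤_; _<_; z≤n; s≤s; _<ᵇ_; _<?_)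
open import Data.Nat.ListAction using (sum)
open import Data.Nat.ListAction.Properties using (sum-++)
open import Data.Nat.Properties
open import Algebra.Properties.CommutativeMonoid.Sum +-0-commutativeMonoid
  using (sum-syntax; sum-cong-≗; sum-replicate-zero; ∑-distrib-+)
open import Data.Nat.Tactic.RingSolver using (solve-∀)
open import Data.Product using (∃; _×_; _,_; uncurry; swap)
open import Data.Sum using (_⊎_; inj₁; inj₂)
open import Data.Vec using (_∷_; []; lookup; _++_; take; drop)
import Data.Vec as Vec
open import Data.Vec.Properties using (lookup-++ˡ; lookup-++ʳ; []=⇒lookup; lookup⇒[]=; take++drop≡id)
open import Function using (id; _∘_; _⇔_; mk⇔; Equivalence)
open import Relation.Binary.Definitions using (tri<; tri≈; tri>)
open import Relation.Binary.PropositionalEquality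
  using (_≡_; _≢_; refl; sym; trans; cong; cong₂; subst; module ≡-Reasoning)
open import Relation.Nullary using (yes; no; contradiction)

odd-*-+1 : ∀ e x → (2 * e + 1) * (x + 1) ≡ suc ((2 * e + 1) * x + 2 * e)
odd-*-+1 = solve-∀

m≤1⇒m*[1+n]≤n+m : ∀ {m} n → m ≤ 1 → m * suc n ≤ n + m
m≤1⇒m*[1+n]≤n+m {zero}        n _        = z≤n
m≤1⇒m*[1+n]≤n+m {suc zero}    n _        = ≤-reflexive (trans (+-identityʳ (suc n)) (sym (+-comm n 1)))
m≤1⇒m*[1+n]≤n+m {suc (suc _)} n (s≤s ())

∑-pigeonhole : ∀ {n} (f : Fin n → ℕ) c → ∑[ i < n ] f i < n * c → ∃ λ i → f i < c
∑-pigeonhole {zero}  f c ()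
∑-pigeonhole {suc n} f c ∑f<n*c with f zero <? c
... | yes f₀<c = zero , f₀<c
... | no  f₀≮c with ∑-pigeonhole (f ∘ suc) c
                      (+-cancelˡ-< c _ _ (≤-<-trans (+-monoˡ-≤ _ (≮⇒≥ f₀≮c)) ∑f<n*c))
...   | i , fᵢ<c = suc i , fᵢ<c

∑-indicator : ∀ {n} (p : Subset n) c → ∑[ i < n ] (if lookup p i then c else 0) ≡ ∣ p ∣ * c
∑-indicator []          c = refl
∑-indicator (true  ∷ p) c = cong (c +_) (∑-indicator p c)
∑-indicator (false ∷ p) c = ∑-indicator p c

sum-map-*ˡ : ∀ {A : Set} k (f : A → ℕ) xs → sum (map (λ x → k * f x) xs) ≡ k * sum (map f xs)
sum-map-*ˡ k f []       = sym (*-zeroʳ k)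
sum-map-*ˡ k f (x ∷ xs) = trans (cong (k * f x +_) (sum-map-*ˡ k f xs)) (sym (*-distribˡ-+ k (f x) _))

sum-map-const : ∀ {A : Set} c (xs : List A) → sum (map (λ _ → c) xs) ≡ length xs * c
sum-map-const c []       = refl
sum-map-const c (x ∷ xs) = cong (c +_) (sum-map-const c xs)

∣p++q∣≡∣p∣+∣q∣ : ∀ {m k} (p : Subset m) (q : Subset k) → ∣ p ++ q ∣ ≡ ∣ p ∣ + ∣ q ∣
∣p++q∣≡∣p∣+∣q∣ []          q = refl
∣p++q∣≡∣p∣+∣q∣ (true  ∷ p) q = cong suc (∣p++q∣≡∣p∣+∣q∣ p q)
∣p++q∣≡∣p∣+∣q∣ (false ∷ p) q = ∣p++q∣≡∣p∣+∣q∣ p q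

module _ {m k} (p : Subset m) {q : Subset k} where

  ∈-++⁺ˡ : ∀ {x} → x ∈ p → (x ↑ˡ k) ∈ p ++ q
  ∈-++⁺ˡ {x} x∈p = lookup⇒[]= _ (p ++ q) (trans (lookup-++ˡ p q x) ([]=⇒lookup x∈p))

  ∈-++⁺ʳ : ∀ {y} → y ∈ q → (m ↑ʳ y) ∈ p ++ q
  ∈-++⁺ʳ {y} y∈q = lookup⇒[]= _ (p ++ q) (trans (lookup-++ʳ p q y) ([]=⇒lookup y∈q))

  ∈-++⁻ˡ : ∀ {x} → (x ↑ˡ k) ∈ p ++ q → x ∈ p
  ∈-++⁻ˡ {x} x∈ = lookup⇒[]= x p (trans (sym (lookup-++ˡ p q x)) ([]=⇒lookup x∈))

  ∈-++⁻ʳ : ∀ {y} → (m ↑ʳ y) ∈ p ++ q → y ∈ q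
  ∈-++⁻ʳ {y} y∈ = lookup⇒[]= y q (trans (sym (lookup-++ʳ p q y)) ([]=⇒lookup y∈))

∣p∪q∣≤∣p∣+∣q∣ : ∀ {m} (p q : Subset m) → ∣ p ∪ q ∣ ≤ ∣ p ∣ + ∣ q ∣
∣p∪q∣≤∣p∣+∣q∣ []          []          = z≤n
∣p∪q∣≤∣p∣+∣q∣ (true  ∷ p) (true  ∷ q) = s≤s (≤-trans (∣p∪q∣≤∣p∣+∣q∣ p q) (+-monoʳ-≤ ∣ p ∣ (n≤1+n ∣ q ∣)))
∣p∪q∣≤∣p∣+∣q∣ (true  ∷ p) (false ∷ q) = s≤s (∣p∪q∣≤∣p∣+∣q∣ p q)
∣p∪q∣≤∣p∣+∣q∣ (false ∷ p) (true  ∷ q) =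
  ≤-trans (s≤s (∣p∪q∣≤∣p∣+∣q∣ p q)) (≤-reflexive (sym (+-suc ∣ p ∣ ∣ q ∣)))
∣p∪q∣≤∣p∣+∣q∣ (false ∷ p) (false ∷ q) = ∣p∪q∣≤∣p∣+∣q∣ p q

∣p─q∣+∣q∣≡∣q∪p∣ : ∀ {m} (p q : Subset m) → ∣ p ─ q ∣ + ∣ q ∣ ≡ ∣ q ∪ p ∣
∣p─q∣+∣q∣≡∣q∪p∣ []          []          = refl
∣p─q∣+∣q∣≡∣q∪p∣ (true  ∷ p) (true  ∷ q) = trans (+-suc ∣ p ─ q ∣ ∣ q ∣) (cong suc (∣p─q∣+∣q∣≡∣q∪p∣ p q))
∣p─q∣+∣q∣≡∣q∪p∣ (true  ∷ p) (false ∷ q) = cong suc (∣p─q∣+∣q∣≡∣q∪p∣ p q)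
∣p─q∣+∣q∣≡∣q∪p∣ (false ∷ p) (true  ∷ q) = trans (+-suc ∣ p ─ q ∣ ∣ q ∣) (cong suc (∣p─q∣+∣q∣≡∣q∪p∣ p q))
∣p─q∣+∣q∣≡∣q∪p∣ (false ∷ p) (false ∷ q) = ∣p─q∣+∣q∣≡∣q∪p∣ p q

IsSubsingleton : ∀ {m} → Subset m → Set
IsSubsingleton p = ∀ {x y} → x ∈ p → y ∈ p → x ≡ y

IsSubsingleton⇒∣p∣≤1 : ∀ {m} (p : Subset m) → IsSubsingleton p → ∣ p ∣ ≤ 1
IsSubsingleton⇒∣p∣≤1         []          _    = z≤n
IsSubsingleton⇒∣p∣≤1 {suc m} (true  ∷ p) uniq =
  s≤s (≤-reflexive (trans (cong ∣_∣ (Empty-unique p-empty)) (∣⊥∣≡0 m)))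
  where
  p-empty : Empty p
  p-empty (x , x∈p) with uniq Vec.here (Vec.there x∈p)
  ... | ()
IsSubsingleton⇒∣p∣≤1         (false ∷ p) uniq =
  IsSubsingleton⇒∣p∣≤1 p (λ x∈p y∈p → Fin.suc-injective (uniq (Vec.there x∈p) (Vec.there y∈p)))

wgt-++ : ∀ {m} (𝒳 𝒴 : List (Subset m)) → wgt (𝒳 L.++ 𝒴) ≡ wgt 𝒳 + wgt 𝒴
wgt-++ 𝒳 𝒴 = trans (cong sum (map-++ ∣_∣ 𝒳 𝒴)) (sum-++ (map ∣_∣ 𝒳) (map ∣_∣ 𝒴))

wgt-concatMap-≤ : ∀ {A : Set} {m} {f : A → List (Subset m)} {g : A → ℕ} →
                  (∀ x → wgt (f x) ≤ g x) → ∀ xs → wgt (concatMap f xs) ≤ sum (map g xs)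
wgt-concatMap-≤ f≤g []       = z≤n
wgt-concatMap-≤ {f = f} f≤g (x ∷ xs) =
  ≤-trans (≤-reflexive (wgt-++ (f x) (concatMap f xs))) (+-mono-≤ (f≤g x) (wgt-concatMap-≤ f≤g xs))

wgt-map-++ : ∀ {m k} (q : Subset k) (𝒳 : List (Subset m)) →
             wgt (map (_++ q) 𝒳) ≡ wgt 𝒳 + length 𝒳 * ∣ q ∣
wgt-map-++ q []      = refl
wgt-map-++ q (D ∷ 𝒳) = begin
  ∣ D ++ q ∣ + wgt (map (_++ q) 𝒳)          ≡⟨ cong₂ _+_ (∣p++q∣≡∣p∣+∣q∣ D q) (wgt-map-++ q 𝒳) ⟩
  ∣ D ∣ + ∣ q ∣ + (wgt 𝒳 + length 𝒳 * ∣ q ∣) ≡⟨ shuffle ∣ D ∣ ∣ q ∣ (wgt 𝒳) (length 𝒳 * ∣ q ∣) ⟩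
  ∣ D ∣ + wgt 𝒳 + (∣ q ∣ + length 𝒳 * ∣ q ∣) ∎
  where
  open ≡-Reasoning
  shuffle : ∀ a b c d → a + b + (c + d) ≡ a + c + (b + d)
  shuffle = solve-∀

wgt-map-++⊥ : ∀ {m k} (𝒳 : List (Subset m)) → wgt (map (_++ ⊥ {k}) 𝒳) ≡ wgt 𝒳
wgt-map-++⊥ {k = k} 𝒳 = begin
  wgt (map (_++ ⊥) 𝒳)              ≡⟨ wgt-map-++ ⊥ 𝒳 ⟩
  wgt 𝒳 + length 𝒳 * ∣ ⊥ {k} ∣     ≡⟨ cong (λ c → wgt 𝒳 + length 𝒳 * c) (∣⊥∣≡0 k) ⟩
  wgt 𝒳 + length 𝒳 * 0             ≡⟨ cong (wgt 𝒳 +_) (*-zeroʳ (length 𝒳)) ⟩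
  wgt 𝒳 + 0                         ≡⟨ +-identityʳ (wgt 𝒳) ⟩
  wgt 𝒳                             ∎
  where open ≡-Reasoning

∣⋃∣≤wgt : ∀ {m} (𝒳 : List (Subset m)) → ∣ ⋃ 𝒳 ∣ ≤ wgt 𝒳
∣⋃∣≤wgt {m} []  = ≤-reflexive (∣⊥∣≡0 m)
∣⋃∣≤wgt (C ∷ 𝒳) = ≤-trans (∣p∪q∣≤∣p∣+∣q∣ C (⋃ 𝒳)) (+-monoʳ-≤ ∣ C ∣ (∣⋃∣≤wgt 𝒳))

∈⋃ : ∀ {m} {x : Fin m} {𝒳} → Any (x ∈_) 𝒳 → x ∈ ⋃ 𝒳
∈⋃ (here x∈C)  = x∈p∪q⁺ (inj₁ x∈C)
∈⋃ (there x∈⋃) = x∈p∪q⁺ (inj₂ (∈⋃ x∈⋃))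

covering⇒m≤wgt : ∀ {m} (𝒳 : List (Subset m)) → (∀ x → Any (x ∈_) 𝒳) → m ≤ wgt 𝒳
covering⇒m≤wgt {m} 𝒳 cover = begin
  m          ≡⟨ sym (∣⊤∣≡n m) ⟩
  ∣ ⊤ {m} ∣  ≤⟨ p⊆q⇒∣p∣≤∣q∣ {p = ⊤} (λ {x} _ → ∈⋃ (cover x)) ⟩
  ∣ ⋃ 𝒳 ∣    ≤⟨ ∣⋃∣≤wgt 𝒳 ⟩
  wgt 𝒳      ∎
  where open ≤-Reasoning

glue : ∀ {m k} → List (Subset m × Subset k) → List (Subset (m + k))
glue = map (uncurry _++_)

unglue : ∀ m {k} → List (Subset (m + k)) → List (Subset m × Subset k)
unglue m = map (λ C → take m C , drop m C)

glue-unglue : ∀ m {k} (𝒞 : List (Subset (m + k))) → glue (unglue m 𝒞) ≡ 𝒞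
glue-unglue m []      = refl
glue-unglue m (C ∷ 𝒞) = cong₂ _∷_ (take++drop≡id m C) (glue-unglue m 𝒞)

disjointify : ∀ {m} → Subset m → List (Subset m) → List (Subset m)
disjointify acc []      = []
disjointify acc (C ∷ 𝒞) = (C ─ acc) ∷ disjointify (acc ∪ C) 𝒞

length-disjointify : ∀ {m} (acc : Subset m) 𝒞 → length (disjointify acc 𝒞) ≡ length 𝒞
length-disjointify acc []      = refl
length-disjointify acc (C ∷ 𝒞) = cong suc (length-disjointify (acc ∪ C) 𝒞)

wgt-disjointify : ∀ {m} (acc : Subset m) 𝒞 → wgt (disjointify acc 𝒞) + ∣ acc ∣ ≤ m
wgt-disjointify     acc []      = ∣p∣≤n acc
wgt-disjointify {m} acc (C ∷ 𝒞) = begin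
  ∣ C ─ acc ∣ + wgt rest + ∣ acc ∣   ≡⟨ shuffle ∣ C ─ acc ∣ (wgt rest) (∣ acc ∣) ⟩
  wgt rest + (∣ C ─ acc ∣ + ∣ acc ∣) ≡⟨ cong (wgt rest +_) (∣p─q∣+∣q∣≡∣q∪p∣ C acc) ⟩
  wgt rest + ∣ acc ∪ C ∣             ≤⟨ wgt-disjointify (acc ∪ C) 𝒞 ⟩
  m                                  ∎
  where
  open ≤-Reasoning
  rest = disjointify (acc ∪ C) 𝒞
  shuffle : ∀ a b c → a + b + c ≡ b + (a + c)
  shuffle = solve-∀

All-disjointify : ∀ {m} {P : Subset m → Set} → (∀ {C D} → D ⊆ C → P C → P D) →
                  ∀ acc {𝒞} → All P 𝒞 → All P (disjointify acc 𝒞)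
All-disjointify P-⊆ acc []         = []
All-disjointify P-⊆ acc {C ∷ 𝒞} (pC ∷ p𝒞) = P-⊆ (p─q⊆p C acc) pC ∷ All-disjointify P-⊆ (acc ∪ C) p𝒞

Any-∈-disjointify : ∀ {m} {x : Fin m} acc {𝒞} → Any (x ∈_) 𝒞 → x ∈ acc ⊎ Any (x ∈_) (disjointify acc 𝒞)
Any-∈-disjointify {x = x} acc x∈𝒞 with x ∈? acc
... | yes x∈acc = inj₁ x∈acc
Any-∈-disjointify acc (here x∈C)  | no x∉acc = inj₂ (here (x∈p∧x∉q⇒x∈p─q x∈C x∉acc))
Any-∈-disjointify acc {C ∷ 𝒞} (there x∈𝒞) | no x∉acc with Any-∈-disjointify (acc ∪ C) x∈𝒞
... | inj₂ x∈rest = inj₂ (there x∈rest)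
... | inj₁ x∈acc∪C with x∈p∪q⁻ acc C x∈acc∪C
...   | inj₁ x∈acc = contradiction x∈acc x∉acc
...   | inj₂ x∈C   = inj₂ (here (x∈p∧x∉q⇒x∈p─q x∈C x∉acc))

IsClique-⊆ : ∀ (G : Graph) {C D} → D ⊆ C → IsClique G C → IsClique G D
IsClique-⊆ G D⊆C cC i j i∈D j∈D = cC i j (D⊆C i∈D) (D⊆C j∈D)

disjoint-node-cover : ∀ (G : Graph) {𝒞} → IsNodeCliqueCover G 𝒞 →
  ∃ λ 𝒟 → IsNodeCliqueCover G 𝒟 × length 𝒟 ≡ length 𝒞 × wgt 𝒟 ≤ n G
disjoint-node-cover G {𝒞} (cliques , cover) =
  𝒟 , (All-disjointify (IsClique-⊆ G) ⊥ cliques , cover𝒟) , length-disjointify ⊥ 𝒞 , wgt𝒟≤n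
  where
  𝒟 = disjointify ⊥ 𝒞
  cover𝒟 : ∀ v → Any (v ∈_) 𝒟
  cover𝒟 v with Any-∈-disjointify ⊥ (cover v)
  ... | inj₁ v∈⊥ = contradiction v∈⊥ ∉⊥
  ... | inj₂ v∈𝒟 = v∈𝒟
  wgt𝒟≤n : wgt 𝒟 ≤ n G
  wgt𝒟≤n = ≤-trans (≤-reflexive (sym (trans (cong (wgt 𝒟 +_) (∣⊥∣≡0 (n G))) (+-identityʳ _))))
                   (wgt-disjointify ⊥ 𝒞)

pair : ∀ {m} → Fin m → Fin m → Subset m
pair a b = ⁅ a ⁆ ∪ ⁅ b ⁆

∈-pair : ∀ {m} (a b : Fin m) → a ∈ pair a b × b ∈ pair a b
∈-pair a b = x∈p∪q⁺ (inj₁ (x∈⁅x⁆ a)) , x∈p∪q⁺ (inj₂ (x∈⁅x⁆ b))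

∣pair∣≤2 : ∀ {m} (a b : Fin m) → ∣ pair a b ∣ ≤ 2
∣pair∣≤2 a b = ≤-trans (∣p∪q∣≤∣p∣+∣q∣ ⁅ a ⁆ ⁅ b ⁆) (≤-reflexive (cong₂ _+_ (∣⁅x⁆∣≡1 a) (∣⁅x⁆∣≡1 b)))

pair-clique : ∀ (G : Graph) {a b} → adj G a b ≡ true → IsClique G (pair a b)
pair-clique G {a} {b} ab i j i∈ j∈ i≢j with x∈p∪q⁻ ⁅ a ⁆ ⁅ b ⁆ i∈ | x∈p∪q⁻ ⁅ a ⁆ ⁅ b ⁆ j∈
... | inj₁ i∈a | inj₁ j∈a = contradiction (trans (x∈⁅y⁆⇒x≡y a i∈a) (sym (x∈⁅y⁆⇒x≡y a j∈a))) i≢j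
... | inj₂ i∈b | inj₂ j∈b = contradiction (trans (x∈⁅y⁆⇒x≡y b i∈b) (sym (x∈⁅y⁆⇒x≡y b j∈b))) i≢j
... | inj₁ i∈a | inj₂ j∈b rewrite x∈⁅y⁆⇒x≡y a i∈a | x∈⁅y⁆⇒x≡y b j∈b = ab
... | inj₂ i∈b | inj₁ j∈a rewrite x∈⁅y⁆⇒x≡y b i∈b | x∈⁅y⁆⇒x≡y a j∈a = trans (adj-sym G b a) ab

singletonIf : ∀ {A : Set} → Bool → A → List A
singletonIf c x = if c then x ∷ [] else []

isOrderedEdge : (G : Graph) → Fin (n G) → Fin (n G) → Bool
isOrderedEdge G a b = adj G a b ∧ (toℕ a <ᵇ toℕ b)

-- Edges are enumerated exactly as ∣E∣ counts them, each once.
edgeCliques : (G : Graph) → List (Subset (n G))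
edgeCliques G = concatMap (λ a → concatMap (λ b → singletonIf (isOrderedEdge G a b) (pair a b))
                                           (allFin (n G)))
                          (allFin (n G))

module _ (G : Graph) where

  edgeCliques-clique : All (IsClique G) (edgeCliques G)
  edgeCliques-clique =
    All.concat⁺ (All.map⁺ (All.tabulate⁺ λ a → All.concat⁺ (All.map⁺ (All.tabulate⁺ λ b → clique a b))))
    where
    clique : ∀ a b → All (IsClique G) (singletonIf (isOrderedEdge G a b) (pair a b))
    clique a b with adj G a b in ab
    ... | false = []
    ... | true with toℕ a <ᵇ toℕ b
    ...   | true  = pair-clique G ab ∷ []
    ...   | false = []

  orderedEdge-cover : ∀ {a b} → adj G a b ≡ true → toℕ a < toℕ b →
                      Any (λ C → a ∈ C × b ∈ C) (edgeCliques G)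
  orderedEdge-cover {a} {b} ab a<b =
    Any.concatMap⁺ _ (Any.tabulate⁺ a (Any.concatMap⁺ _ (Any.tabulate⁺ b inSingleton)))
    where
    inSingleton : Any (λ C → a ∈ C × b ∈ C) (singletonIf (isOrderedEdge G a b) (pair a b))
    inSingleton rewrite ab | Equivalence.to T-≡ (<⇒<ᵇ a<b) = here (∈-pair a b)

  edgeCliques-cover : ∀ {a b} → adj G a b ≡ true → Any (λ C → a ∈ C × b ∈ C) (edgeCliques G)
  edgeCliques-cover {a} {b} ab with <-cmp (toℕ a) (toℕ b)
  ... | tri< a<b _ _ = orderedEdge-cover ab a<b
  ... | tri> _ _ b<a = Any.map swap (orderedEdge-cover (trans (adj-sym G b a) ab) b<a)
  ... | tri≈ _ a≡b _ =
    contradiction (trans (sym ab) (trans (cong (adj G a) (sym (toℕ-injective a≡b))) (irrefl G a))) λ ()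

  wgt-edgeCliques : wgt (edgeCliques G) ≤ 2 * ∣E∣ G
  wgt-edgeCliques = begin
    wgt (edgeCliques G)
      ≤⟨ wgt-concatMap-≤ (λ a → wgt-concatMap-≤ (wgt-singletonIf a) all) all ⟩
    sum (map (λ a → sum (map (λ b → 2 * indicator a b) all)) all)
      ≡⟨ cong sum (map-cong (λ a → sum-map-*ˡ 2 (indicator a) all) all) ⟩
    sum (map (λ a → 2 * sum (map (indicator a) all)) all)
      ≡⟨ sum-map-*ˡ 2 (λ a → sum (map (indicator a) all)) all ⟩
    2 * ∣E∣ G ∎
    where
    open ≤-Reasoning
    all = allFin (n G)
    indicator : Fin (n G) → Fin (n G) → ℕ
    indicator a b = if isOrderedEdge G a b then 1 else 0
    wgt-singletonIf : ∀ a b → wgt (singletonIf (isOrderedEdge G a b) (pair a b)) ≤ 2 * indicator a b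
    wgt-singletonIf a b with isOrderedEdge G a b
    ... | true  = ≤-trans (≤-reflexive (+-identityʳ _)) (∣pair∣≤2 a b)
    ... | false = z≤n

module _ (G : Graph) (ℓ : ℕ) where

  data Vertex : Fin (n G + ℓ) → Set where
    old : ∀ a → Vertex (a ↑ˡ ℓ)
    new : ∀ j → Vertex (n G ↑ʳ j)

  vertex : ∀ x → Vertex x
  vertex x with splitAt (n G) x in eq
  ... | inj₁ a = subst Vertex (splitAt⁻¹-↑ˡ eq) (old a)
  ... | inj₂ j = subst Vertex (splitAt⁻¹-↑ʳ eq) (new j)

  adj-old-old : ∀ a b → adj (G ^^ ℓ) (a ↑ˡ ℓ) (b ↑ˡ ℓ) ≡ adj G a b
  adj-old-old a b rewrite splitAt-↑ˡ (n G) a ℓ | splitAt-↑ˡ (n G) b ℓ = refl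

  adj-old-new : ∀ a j → adj (G ^^ ℓ) (a ↑ˡ ℓ) (n G ↑ʳ j) ≡ true
  adj-old-new a j rewrite splitAt-↑ˡ (n G) a ℓ | splitAt-↑ʳ (n G) ℓ j = refl

  adj-new-old : ∀ j a → adj (G ^^ ℓ) (n G ↑ʳ j) (a ↑ˡ ℓ) ≡ true
  adj-new-old j a rewrite splitAt-↑ˡ (n G) a ℓ | splitAt-↑ʳ (n G) ℓ j = refl

  adj-new-new : ∀ i j → adj (G ^^ ℓ) (n G ↑ʳ i) (n G ↑ʳ j) ≡ false
  adj-new-new i j rewrite splitAt-↑ʳ (n G) ℓ i | splitAt-↑ʳ (n G) ℓ j = refl

  clique-++⁺ : ∀ {A B} → IsClique G A → IsSubsingleton B → IsClique (G ^^ ℓ) (A ++ B)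
  clique-++⁺ {A} cA sB x y x∈ y∈ x≢y with vertex x | vertex y
  ... | old a | old b = trans (adj-old-old a b) (cA a b (∈-++⁻ˡ A x∈) (∈-++⁻ˡ A y∈) (x≢y ∘ cong (_↑ˡ ℓ)))
  ... | old a | new j = adj-old-new a j
  ... | new i | old b = adj-new-old i b
  ... | new i | new j = contradiction (cong (n G ↑ʳ_) (sB (∈-++⁻ʳ A x∈) (∈-++⁻ʳ A y∈))) x≢y

  clique-++⁻ˡ : ∀ {A B} → IsClique (G ^^ ℓ) (A ++ B) → IsClique G A
  clique-++⁻ˡ {A} c a b a∈ b∈ a≢b =
    trans (sym (adj-old-old a b)) (c _ _ (∈-++⁺ˡ A a∈) (∈-++⁺ˡ A b∈) (a≢b ∘ ↑ˡ-injective ℓ a b))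

  clique-++⁻ʳ : ∀ {A B} → IsClique (G ^^ ℓ) (A ++ B) → IsSubsingleton B
  clique-++⁻ʳ {A} c {i} {j} i∈ j∈ with i Fin.≟ j
  ... | yes i≡j = i≡j
  ... | no  i≢j = contradiction
    (trans (sym (adj-new-new i j)) (c _ _ (∈-++⁺ʳ A i∈) (∈-++⁺ʳ A j∈) (i≢j ∘ ↑ʳ-injective (n G) i j)))
    λ ()

  stars : List (Subset (n G)) → List (Subset (n G + ℓ))
  stars 𝒟 = concatMap (λ j → map (_++ ⁅ j ⁆) 𝒟) (allFin ℓ)

  wgt-stars : ∀ 𝒟 → wgt (stars 𝒟) ≤ ℓ * (wgt 𝒟 + length 𝒟)
  wgt-stars 𝒟 = begin
    wgt (stars 𝒟)                     ≤⟨ wgt-concatMap-≤ (≤-reflexive ∘ wgt-star) (allFin ℓ) ⟩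
    sum (map (λ _ → c) (allFin ℓ))    ≡⟨ sum-map-const c (allFin ℓ) ⟩
    length (allFin ℓ) * c             ≡⟨ cong (_* c) (length-tabulate {n = ℓ} id) ⟩
    ℓ * c                             ∎
    where
    open ≤-Reasoning
    c = wgt 𝒟 + length 𝒟
    wgt-star : ∀ j → wgt (map (_++ ⁅ j ⁆) 𝒟) ≡ c
    wgt-star j = trans (wgt-map-++ ⁅ j ⁆ 𝒟)
                       (cong (wgt 𝒟 +_) (trans (cong (length 𝒟 *_) (∣⁅x⁆∣≡1 j)) (*-identityʳ _)))

  stars-clique : ∀ {𝒟} → All (IsClique G) 𝒟 → All (IsClique (G ^^ ℓ)) (stars 𝒟)
  stars-clique cl =
    All.concat⁺ (All.map⁺ (All.tabulate⁺ λ j →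
      All.map⁺ (All.map (λ cD → clique-++⁺ cD (⁅⁆-subsingleton j)) cl)))
    where
    ⁅⁆-subsingleton : ∀ j → IsSubsingleton ⁅ j ⁆
    ⁅⁆-subsingleton j x∈ y∈ = trans (x∈⁅y⁆⇒x≡y j x∈) (sym (x∈⁅y⁆⇒x≡y j y∈))

  stars-cover : ∀ {𝒟 a} j → Any (a ∈_) 𝒟 → Any (λ C → (a ↑ˡ ℓ) ∈ C × (n G ↑ʳ j) ∈ C) (stars 𝒟)
  stars-cover j a∈𝒟 =
    Any.concatMap⁺ _ (Any.tabulate⁺ j
      (Any.map⁺ (Any.map (λ {D} a∈D → ∈-++⁺ˡ D a∈D , ∈-++⁺ʳ D (x∈⁅x⁆ j)) a∈𝒟)))

  liftedEdgeCliques : List (Subset (n G + ℓ))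
  liftedEdgeCliques = map (_++ ⊥) (edgeCliques G)

  stars-liftedEdges-sigma-cover : ∀ {𝒟} → IsNodeCliqueCover G 𝒟 →
                                  IsSigmaCliqueCover (G ^^ ℓ) (stars 𝒟 L.++ liftedEdgeCliques)
  stars-liftedEdges-sigma-cover {𝒟} (cliques , cover) =
    All.++⁺ (stars-clique cliques) lifted-clique , edges-covered
    where
    lifted-clique : All (IsClique (G ^^ ℓ)) liftedEdgeCliques
    lifted-clique =
      All.map⁺ (All.map (λ c → clique-++⁺ c (λ x∈⊥ → contradiction x∈⊥ ∉⊥)) (edgeCliques-clique G))
    edges-covered : ∀ x y → adj (G ^^ ℓ) x y ≡ true →
                    Any (λ C → x ∈ C × y ∈ C) (stars 𝒟 L.++ liftedEdgeCliques)
    edges-covered x y xy with vertex x | vertex y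
    ... | old a | old b =
      Any.++⁺ʳ (stars 𝒟) (Any.map⁺ (Any.map (λ {C} (a∈ , b∈) → ∈-++⁺ˡ C a∈ , ∈-++⁺ˡ C b∈)
                                           (edgeCliques-cover G (trans (sym (adj-old-old a b)) xy))))
    ... | old a | new j = Any.++⁺ˡ (stars-cover j (cover a))
    ... | new j | old a = Any.++⁺ˡ (Any.map swap (stars-cover j (cover a)))
    ... | new i | new j = contradiction (trans (sym xy) (adj-new-new i j)) λ ()

  node-cover⇒sigma-cover : ∀ s → NodeCliqueCoverYes G s →
                           SigmaCliqueCoverYes (G ^^ ℓ) (ℓ * (n G + s) + 2 * ∣E∣ G)
  node-cover⇒sigma-cover s (𝒞 , cover , length𝒞≤s) with disjoint-node-cover G cover
  ... | 𝒟 , cover𝒟 , length𝒟≡length𝒞 , wgt𝒟≤n =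
    stars 𝒟 L.++ liftedEdgeCliques , stars-liftedEdges-sigma-cover cover𝒟 , weight
    where
    open ≤-Reasoning
    length𝒟≤s : length 𝒟 ≤ s
    length𝒟≤s = subst (_≤ s) (sym length𝒟≡length𝒞) length𝒞≤s
    weight : wgt (stars 𝒟 L.++ liftedEdgeCliques) ≤ ℓ * (n G + s) + 2 * ∣E∣ G
    weight = begin
      wgt (stars 𝒟 L.++ liftedEdgeCliques)
        ≡⟨ wgt-++ (stars 𝒟) liftedEdgeCliques ⟩
      wgt (stars 𝒟) + wgt liftedEdgeCliques
        ≤⟨ +-mono-≤ (wgt-stars 𝒟) (≤-reflexive (wgt-map-++⊥ (edgeCliques G))) ⟩
      ℓ * (wgt 𝒟 + length 𝒟) + wgt (edgeCliques G)
        ≤⟨ +-mono-≤ (*-monoʳ-≤ ℓ (+-mono-≤ wgt𝒟≤n length𝒟≤s)) (wgt-edgeCliques G) ⟩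
      ℓ * (n G + s) + 2 * ∣E∣ G
        ∎

  -- A vertex set of G^ℓ is handled as A ++ B with A ⊆ V and B ⊆ {u₁, …, u_ℓ}.
  trace : Fin ℓ → List (Subset (n G) × Subset ℓ) → List (Subset (n G))
  trace j []            = []
  trace j ((A , B) ∷ 𝒫) = if lookup B j then A ∷ trace j 𝒫 else trace j 𝒫

  trace-clique : ∀ j 𝒫 → All (IsClique (G ^^ ℓ)) (glue 𝒫) → All (IsClique G) (trace j 𝒫)
  trace-clique j []            []       = []
  trace-clique j ((A , B) ∷ 𝒫) (c ∷ cs) with lookup B j
  ... | true  = clique-++⁻ˡ c ∷ trace-clique j 𝒫 cs
  ... | false = trace-clique j 𝒫 cs

  trace-cover : ∀ j v 𝒫 → Any (λ C → (v ↑ˡ ℓ) ∈ C × (n G ↑ʳ j) ∈ C) (glue 𝒫) → Any (v ∈_) (trace j 𝒫)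
  trace-cover j v ((A , B) ∷ 𝒫) (here (v∈ , j∈)) rewrite []=⇒lookup (∈-++⁻ʳ A j∈) = here (∈-++⁻ˡ A v∈)
  trace-cover j v ((A , B) ∷ 𝒫) (there v,j∈𝒫) with lookup B j
  ... | true  = there (trace-cover j v 𝒫 v,j∈𝒫)
  ... | false = trace-cover j v 𝒫 v,j∈𝒫

  traceCost : Fin ℓ → List (Subset (n G) × Subset ℓ) → ℕ
  traceCost j 𝒫 = wgt (trace j 𝒫) + length (trace j 𝒫)

  traceCost-∷ : ∀ j A B 𝒫 →
                traceCost j ((A , B) ∷ 𝒫) ≡ (if lookup B j then suc ∣ A ∣ else 0) + traceCost j 𝒫
  traceCost-∷ j A B 𝒫 with lookup B j
  ... | true  = shuffle ∣ A ∣ (wgt (trace j 𝒫)) (length (trace j 𝒫))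
    where
    shuffle : ∀ a w l → a + w + suc l ≡ suc a + (w + l)
    shuffle = solve-∀
  ... | false = refl

  ∑-traceCost≤wgt : ∀ 𝒫 → All (IsClique (G ^^ ℓ)) (glue 𝒫) → ∑[ j < ℓ ] traceCost j 𝒫 ≤ wgt (glue 𝒫)
  ∑-traceCost≤wgt []            []       = ≤-reflexive (sum-replicate-zero ℓ)
  ∑-traceCost≤wgt ((A , B) ∷ 𝒫) (c ∷ cs) = begin
    ∑[ j < ℓ ] traceCost j ((A , B) ∷ 𝒫)
      ≡⟨ sum-cong-≗ (λ j → traceCost-∷ j A B 𝒫) ⟩
    ∑[ j < ℓ ] (indicator j + traceCost j 𝒫)
      ≡⟨ ∑-distrib-+ indicator (λ j → traceCost j 𝒫) ⟩
    ∑[ j < ℓ ] indicator j + ∑[ j < ℓ ] traceCost j 𝒫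
      ≡⟨ cong (_+ _) (∑-indicator B (suc ∣ A ∣)) ⟩
    ∣ B ∣ * suc ∣ A ∣ + ∑[ j < ℓ ] traceCost j 𝒫
      ≤⟨ +-mono-≤ (m≤1⇒m*[1+n]≤n+m ∣ A ∣ (IsSubsingleton⇒∣p∣≤1 B (clique-++⁻ʳ c)))
                  (∑-traceCost≤wgt 𝒫 cs) ⟩
    ∣ A ∣ + ∣ B ∣ + wgt (glue 𝒫)
      ≡⟨ cong (_+ _) (sym (∣p++q∣≡∣p∣+∣q∣ A B)) ⟩
    wgt (glue ((A , B) ∷ 𝒫))
      ∎
    where
    open ≤-Reasoning
    indicator : Fin ℓ → ℕ
    indicator j = if lookup B j then suc ∣ A ∣ else 0

  glued-sigma-cover⇒node-cover : ∀ s 𝒫 → IsSigmaCliqueCover (G ^^ ℓ) (glue 𝒫) →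
                                 wgt (glue 𝒫) < ℓ * suc (n G + s) → NodeCliqueCoverYes G s
  glued-sigma-cover⇒node-cover s 𝒫 (cliques , edges-covered) light
    with ∑-pigeonhole (λ j → traceCost j 𝒫) (suc (n G + s)) (≤-<-trans (∑-traceCost≤wgt 𝒫 cliques) light)
  ... | j , cheap = trace j 𝒫 , (trace-clique j 𝒫 cliques , cover) , +-cancelˡ-≤ (n G) _ _ n+length≤n+s
    where
    cover : ∀ v → Any (v ∈_) (trace j 𝒫)
    cover v = trace-cover j v 𝒫 (edges-covered _ _ (adj-old-new v j))
    open ≤-Reasoning
    n+length≤n+s : n G + length (trace j 𝒫) ≤ n G + s
    n+length≤n+s = begin
      n G + length (trace j 𝒫) ≤⟨ +-monoˡ-≤ _ (covering⇒m≤wgt _ cover) ⟩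
      traceCost j 𝒫            ≤⟨ m<1+n⇒m≤n cheap ⟩
      n G + s                  ∎

  sigma-cover⇒node-cover : ∀ s w → w < ℓ * (n G + s + 1) →
                           SigmaCliqueCoverYes (G ^^ ℓ) w → NodeCliqueCoverYes G s
  sigma-cover⇒node-cover s w w< (𝒞 , sigma , wgt≤w) =
    glued-sigma-cover⇒node-cover s (unglue (n G) 𝒞)
      (subst (IsSigmaCliqueCover (G ^^ ℓ)) (sym (glue-unglue (n G) 𝒞)) sigma)
      (subst (λ 𝒳 → wgt 𝒳 < ℓ * suc (n G + s)) (sym (glue-unglue (n G) 𝒞))
             (≤-<-trans wgt≤w (subst (w <_) (cong (ℓ *_) (+-comm (n G + s) 1)) w<)))

lemma1 : (G : Graph) (s : ℕ) →
    let ℓ = 2 * ∣E∣ G + 1 in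
    NodeCliqueCoverYes G s ⇔ SigmaCliqueCoverYes (G ^^ ℓ) (ℓ * (∣V∣ G + s + 1) ∸ 1)
lemma1 G s = mk⇔
  (subst (SigmaCliqueCoverYes (G ^^ ℓ)) (sym (cong (_∸ 1) budget≡)) ∘ node-cover⇒sigma-cover G ℓ s)
  (sigma-cover⇒node-cover G ℓ s _ (subst (λ t → t ∸ 1 < t) (sym budget≡) ≤-refl))
  where
  ℓ = 2 * ∣E∣ G + 1
  budget≡ : ℓ * (∣V∣ G + s + 1) ≡ suc (ℓ * (∣V∣ G + s) + 2 * ∣E∣ G)
  budget≡ = odd-*-+1 (∣E∣ G) (∣V∣ G + s)
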